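{- Let $\lambda$ be a partition and $i\ge1$ with $\lambda_{i+1}\ge1$. Fix a filling $w=w_1,\dots,w_{\lambda_i}$ of row $i$, and let $a_1,\dots,a_{\lambda_{i+1}}$ be positive integers whose distinct values occur with multiplicities $m_1,\dots,m_k$. Then $$\sum_r q^{\operatorname{inv}_w(r)}=\binom{\lambda_{i+1}}{m_1,\dots,m_k}_q=\frac{(\lambda_{i+1})_q!}{(m_1)_q!\cdots(m_k)_q!},$$ where the sum ranges over all distinct fillings $r$ of row $i+1$ by $a_1,\dots,a_{\lambda_{i+1}}$ in some order.
   Context: Rows are numbered from the bottom (French notation), so row $i+1$ lies directly above row $i$ and the cell in column $j$ of row $i+1$ is above $w_j$. $\operatorname{inv}_w(r)$ is the number of relative inversions in row $r$ given $w$ below it: pairs $u,v$ in row $r$, $u$ left of $v$, such that with $b$ the entry of $w$ directly below $u$, $u\le b<v$, or $b<v<u$, or $v<u\le b$. $(m)_q!=\prod_{j=1}^m(1+q+\cdots+q^{j-1})$. -}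

module Defs where

open import Level using (Level)
open import Data.Nat using (ℕ; zero; suc; _≤ᵇ_; _<ᵇ_) renaming (_+_ to _+ℕ_)
import Data.Nat as N
open import Data.Bool using (Bool; true; false; _∧_; _∨_; if_then_else_)
open import Data.List using (List; []; _∷_; map; concatMap; deduplicate; length; filter)
open import Data.List.Properties using (≡-dec)
open import Data.List.Relation.Unary.Linked using (Linked)
open import Relation.Binary.PropositionalEquality using (_≡_)
open import Algebra.Bundles using (CommutativeSemiring)

IsPartition : List ℕ → Set
IsPartition = Linked N._≥_

-- λ_j, 1-indexed, with λ_j = 0 beyond the length (and for j = 0).
part : List ℕ → ℕ → ℕ
part []       _             = 0
part (x ∷ xs) zero          = 0
part (x ∷ xs) (suc zero)    = x
part (x ∷ xs) (suc (suc j)) = part xs (suc j)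

-- Relative inversion condition for u left of v in the upper row, b below u:
-- u ≤ b < v, or b < v < u, or v < u ≤ b.
relInv : ℕ → ℕ → ℕ → Bool
relInv u b v = ((u ≤ᵇ b) ∧ (b <ᵇ v)) ∨ ((b <ᵇ v) ∧ (v <ᵇ u)) ∨ ((v <ᵇ u) ∧ (u ≤ᵇ b))

-- inv_w(r): first argument the row w below, second the row r above
-- (entry k of r sits above entry k of w; length r ≤ length w).
inv : List ℕ → List ℕ → ℕ
inv (b ∷ w) (u ∷ r) = length (filter (λ v → relInv u b v Data.Bool.≟ true) r) +ℕ inv w r
  where import Data.Bool
inv _       _       = 0

insertAll : ℕ → List ℕ → List (List ℕ)
insertAll x []       = (x ∷ []) ∷ []
insertAll x (y ∷ ys) = (x ∷ y ∷ ys) ∷ map (y ∷_) (insertAll x ys)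

perms : List ℕ → List (List ℕ)
perms []       = [] ∷ []
perms (x ∷ xs) = concatMap (insertAll x) (perms xs)

distinctFillings : List ℕ → List (List ℕ)
distinctFillings a = deduplicate (≡-dec N._≟_) (perms a)

mult : ℕ → List ℕ → ℕ
mult v a = length (filter (N._≟ v) a)

distinctValues : List ℕ → List ℕ
distinctValues = deduplicate N._≟_

module _ {c ℓ : Level} (R : CommutativeSemiring c ℓ) where
  open CommutativeSemiring R

  pow : Carrier → ℕ → Carrier
  pow q zero    = 1#
  pow q (suc n) = q * pow q n

  sumR : List Carrier → Carrier
  sumR []       = 0#
  sumR (x ∷ xs) = x + sumR xs

  prodR : List Carrier → Carrier
  prodR []       = 1#
  prodR (x ∷ xs) = x * prodR xs

  qInt : Carrier → ℕ → Carrier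
  qInt q zero    = 0#
  qInt q (suc j) = 1# + q * qInt q j

  qFact : Carrier → ℕ → Carrier
  qFact q zero    = 1#
  qFact q (suc m) = qInt q (suc m) * qFact q m

  invGen : Carrier → List ℕ → List ℕ → Carrier
  invGen q w a = sumR (map (λ r → pow q (inv w r)) (distinctFillings a))

  multFactProd : Carrier → List ℕ → Carrier
  multFactProd q a = prodR (map (λ v → qFact q (mult v a)) (distinctValues a))

-- Fix the entry b of w under the first cell of row i+1. The relative inversions formed by a first entry x
-- are exactly the later entries v preceding x in the cyclic order ≺_b of ℕ that starts at b + 1, and the
-- count of those depends only on the multiset a. Grouping the fillings by their first entry therefore gives
--   ∑_r q^{inv_w(r)} = ∑_x q^{#{v ∈ a : v ≺_b x}} · ∑_{r'} q^{inv_{w'}(r')}   (r' a filling by a ∖ x),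
-- and since (m_x)_q! = [m_x]_q · (m_x − 1)_q!, induction on the row length reduces the theorem to
--   ∑_x q^{#{v ∈ a : v ≺_b x}} [m_x]_q = [|a|]_q,
-- which holds for every strict total order: removing a least entry t of a turns the sum S(a) into 1 + q S(a ∖ t).

module Submission where

open import Defs
open import Level using (Level; 0ℓ)
open import Function using (_∘_; mk⇔)
open import Data.Bool as Bool using (Bool; true; false; not; f<t) renaming (_≟_ to _≟ᵇ_)
import Data.Bool.Properties as Bool
open import Data.Nat as ℕ using (ℕ; zero; suc; _≤_; _≤ᵇ_; _<ᵇ_; s≤s)
import Data.Nat.Properties as ℕ
open import Data.Product using (∃; _×_; _,_)
open import Data.Product.Relation.Binary.Lex.Strict using (×-Lex; ×-isStrictTotalOrder)
open import Data.Sum using (inj₁; inj₂)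
open import Data.List using (List; []; _∷_; _++_; map; concatMap; length; filter)
open import Data.List.Properties using (≡-dec; ∷-injectiveʳ; filter-accept; filter-reject; filter-none; map-∘)
open import Data.List.Membership.Propositional using (_∈_; _∉_; find; lose)
open import Data.List.Membership.Propositional.Properties
  using (∈-map⁺; ∈-map⁻; ∈-∃++; ∈-concatMap⁺; ∈-concatMap⁻; ∈-deduplicate⁺; ∈-deduplicate⁻)
open import Data.List.Membership.Propositional.Properties.WithK using (unique∧set⇒bag)
open import Data.List.Relation.Unary.Any using (here; there)
import Data.List.Relation.Unary.Linked as Linked
open import Data.List.Relation.Unary.All as All using (All; []; _∷_)
import Data.List.Relation.Unary.All.Properties as All
import Data.List.Relation.Unary.AllPairs as AllPairs
open AllPairs using (_∷_)
import Data.List.Relation.Unary.AllPairs.Properties as AllPairs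
open import Data.List.Relation.Unary.Unique.Propositional using (Unique)
import Data.List.Relation.Unary.Unique.Propositional.Properties as Unique
open import Data.List.Relation.Unary.Unique.DecPropositional.Properties using (deduplicate-!)
open import Data.List.Relation.Binary.Subset.Propositional using (_⊆_)
open import Data.List.Relation.Binary.Permutation.Propositional
  using (_↭_; ↭-refl; ↭-sym; ↭-trans; ↭-prep; ↭-swap)
import Data.List.Relation.Binary.Permutation.Propositional as ↭
open import Data.List.Relation.Binary.Permutation.Propositional.Properties
  using (∈-resp-↭; ↭-length; ↭-empty-inv; drop-mid; drop-∷; filter-↭)
open import Data.List.Relation.Binary.BagAndSetEquality using (∼bag⇒↭)
open import Relation.Nullary using (¬_; Dec; yes; no; contradiction; ofʸ; ofⁿ)
open import Relation.Unary as Pred using (Pred)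
open import Relation.Binary using (Rel; Decidable; Transitive; Trichotomous; tri<; tri≈; tri>; IsStrictTotalOrder)
open import Relation.Binary.PropositionalEquality as ≡ using (_≡_; _≢_; cong; cong₂)
open import Algebra.Bundles using (CommutativeSemiring)

-- Distinct fillings

delete : ℕ → List ℕ → List ℕ
delete x []       = []
delete x (y ∷ ys) with x ℕ.≟ y
... | yes _ = ys
... | no  _ = y ∷ delete x ys

↭-delete : ∀ {x xs} → x ∈ xs → xs ↭ x ∷ delete x xs
↭-delete {x} {y ∷ ys} _            with x ℕ.≟ y
↭-delete {x} {y ∷ ys} _            | yes ≡.refl = ↭-refl
↭-delete {x} {y ∷ ys} (here x≡y)   | no  x≢y    = contradiction x≡y x≢y
↭-delete {x} {y ∷ ys} (there x∈ys) | no  _      = ↭-trans (↭-prep y (↭-delete x∈ys)) (↭-swap y x ↭-refl)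

delete-⊆ : ∀ {x xs} → x ∈ xs → delete x xs ⊆ xs
delete-⊆ x∈xs = ∈-resp-↭ (↭-sym (↭-delete x∈xs)) ∘ there

length-filter-↭ : {A : Set} {P : Pred A 0ℓ} (P? : Pred.Decidable P) {xs ys : List A} →
                  xs ↭ ys → length (filter P? xs) ≡ length (filter P? ys)
length-filter-↭ P? = ↭-length ∘ filter-↭ P?

mult-↭ : ∀ v {xs ys} → xs ↭ ys → mult v xs ≡ mult v ys
mult-↭ v = length-filter-↭ (ℕ._≟ v)

mult-∷-≡ : ∀ v xs → mult v (v ∷ xs) ≡ suc (mult v xs)
mult-∷-≡ v xs = cong length (filter-accept (ℕ._≟ v) ≡.refl)

mult-∷-≢ : ∀ {v y} xs → y ≢ v → mult v (y ∷ xs) ≡ mult v xs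
mult-∷-≢ xs y≢v = cong length (filter-reject (ℕ._≟ _) y≢v)

mult-∉ : ∀ {v xs} → v ∉ xs → mult v xs ≡ 0
mult-∉ v∉xs = cong length (filter-none (ℕ._≟ _) (All.tabulate λ y∈xs y≡v → v∉xs (≡.subst (_∈ _) y≡v y∈xs)))

∈-distinctValues⁺ : ∀ {x xs} → x ∈ xs → x ∈ distinctValues xs
∈-distinctValues⁺ = ∈-deduplicate⁺ ℕ._≟_

∈-distinctValues⁻ : ∀ {x} xs → x ∈ distinctValues xs → x ∈ xs
∈-distinctValues⁻ xs = ∈-deduplicate⁻ ℕ._≟_ xs

distinctValues-! : ∀ xs → Unique (distinctValues xs)
distinctValues-! = deduplicate-! ℕ._≟_

unique-concatMap : {A B : Set} (f : A → List B) {xs : List A} →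
                   (∀ x → Unique (f x)) → (∀ {x y z} → z ∈ f x → z ∈ f y → x ≡ y) →
                   Unique xs → Unique (concatMap f xs)
unique-concatMap f f-! f-disjoint xs-! = Unique.concat⁺
  (All.map⁺ (All.tabulate λ {x} _ → f-! x))
  (AllPairs.map⁺ (AllPairs.map (λ x≢y {_} (z∈fx , z∈fy) → x≢y (f-disjoint z∈fx z∈fy)) xs-!))

∈-insertAll⁻ : ∀ x ys {zs} → zs ∈ insertAll x ys → zs ↭ x ∷ ys
∈-insertAll⁻ x []       (here ≡.refl) = ↭-refl
∈-insertAll⁻ x (y ∷ ys) (here ≡.refl) = ↭-refl
∈-insertAll⁻ x (y ∷ ys) (there zs∈)   with ∈-map⁻ (y ∷_) zs∈
... | zs , zs∈′ , ≡.refl = ↭-trans (↭-prep y (∈-insertAll⁻ x ys zs∈′)) (↭-swap y x ↭-refl)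

∈-insertAll⁺ : ∀ x us vs → us ++ x ∷ vs ∈ insertAll x (us ++ vs)
∈-insertAll⁺ x []       []       = here ≡.refl
∈-insertAll⁺ x []       (v ∷ vs) = here ≡.refl
∈-insertAll⁺ x (u ∷ us) vs       = there (∈-map⁺ (u ∷_) (∈-insertAll⁺ x us vs))

∈-perms⁻ : ∀ xs {zs} → zs ∈ perms xs → zs ↭ xs
∈-perms⁻ []       (here ≡.refl) = ↭-refl
∈-perms⁻ (x ∷ xs) zs∈ with find (∈-concatMap⁻ (insertAll x) {xs = perms xs} zs∈)
... | ys , ys∈ , zs∈′ = ↭-trans (∈-insertAll⁻ x ys zs∈′) (↭-prep x (∈-perms⁻ xs ys∈))

∈-perms⁺ : ∀ xs {zs} → zs ↭ xs → zs ∈ perms xs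
∈-perms⁺ []       zs↭ with ↭-empty-inv zs↭
... | ≡.refl = here ≡.refl
∈-perms⁺ (x ∷ xs) zs↭ with ∈-∃++ (∈-resp-↭ (↭-sym zs↭) (here ≡.refl))
... | us , vs , ≡.refl =
  ∈-concatMap⁺ (insertAll x) (lose (∈-perms⁺ xs (drop-mid us [] zs↭)) (∈-insertAll⁺ x us vs))

∈-distinctFillings⁻ : ∀ xs {zs} → zs ∈ distinctFillings xs → zs ↭ xs
∈-distinctFillings⁻ xs = ∈-perms⁻ xs ∘ ∈-deduplicate⁻ (≡-dec ℕ._≟_) (perms xs)

∈-distinctFillings⁺ : ∀ xs {zs} → zs ↭ xs → zs ∈ distinctFillings xs
∈-distinctFillings⁺ xs = ∈-deduplicate⁺ (≡-dec ℕ._≟_) ∘ ∈-perms⁺ xs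

distinctFillings-! : ∀ xs → Unique (distinctFillings xs)
distinctFillings-! xs = deduplicate-! (≡-dec ℕ._≟_) (perms xs)

fillingsStartingWith : List ℕ → ℕ → List (List ℕ)
fillingsStartingWith xs x = map (x ∷_) (distinctFillings (delete x xs))

fillingsByFirstEntry : List ℕ → List (List ℕ)
fillingsByFirstEntry xs = concatMap (fillingsStartingWith xs) (distinctValues xs)

∈-fillingsByFirstEntry⁻ : ∀ xs {zs} → zs ∈ fillingsByFirstEntry xs → zs ↭ xs
∈-fillingsByFirstEntry⁻ xs zs∈ with find (∈-concatMap⁻ (fillingsStartingWith xs) {xs = distinctValues xs} zs∈)
... | x , x∈ , zs∈′ with ∈-map⁻ (x ∷_) zs∈′
... | zs , zs∈″ , ≡.refl =
  ↭-trans (↭-prep x (∈-distinctFillings⁻ _ zs∈″)) (↭-sym (↭-delete (∈-distinctValues⁻ xs x∈)))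

∈-fillingsByFirstEntry⁺ : ∀ y ys {zs} → zs ↭ y ∷ ys → zs ∈ fillingsByFirstEntry (y ∷ ys)
∈-fillingsByFirstEntry⁺ y ys {[]}     zs↭ with () ← ↭-length zs↭
∈-fillingsByFirstEntry⁺ y ys {z ∷ zs} zs↭ =
  ∈-concatMap⁺ (fillingsStartingWith xs)
    (lose (∈-distinctValues⁺ z∈xs)
          (∈-map⁺ (z ∷_) (∈-distinctFillings⁺ _ (drop-∷ (↭-trans zs↭ (↭-delete z∈xs))))))
  where
  xs = y ∷ ys
  z∈xs : z ∈ xs
  z∈xs = ∈-resp-↭ zs↭ (here ≡.refl)

fillingsByFirstEntry-! : ∀ xs → Unique (fillingsByFirstEntry xs)
fillingsByFirstEntry-! xs = unique-concatMap (fillingsStartingWith xs)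
  (λ x → Unique.map⁺ ∷-injectiveʳ (distinctFillings-! (delete x xs))) same-head (distinctValues-! xs)
  where
  same-head : ∀ {x y zs} → zs ∈ fillingsStartingWith xs x → zs ∈ fillingsStartingWith xs y → x ≡ y
  same-head zs∈x zs∈y with ∈-map⁻ _ zs∈x | ∈-map⁻ _ zs∈y
  ... | _ , _ , ≡.refl | _ , _ , ≡.refl = ≡.refl

distinctFillings-↭-byFirstEntry : ∀ y ys → distinctFillings (y ∷ ys) ↭ fillingsByFirstEntry (y ∷ ys)
distinctFillings-↭-byFirstEntry y ys = ∼bag⇒↭ (unique∧set⇒bag
  (distinctFillings-! (y ∷ ys)) (fillingsByFirstEntry-! (y ∷ ys))
  (mk⇔ (∈-fillingsByFirstEntry⁺ y ys ∘ ∈-distinctFillings⁻ (y ∷ ys))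
       (∈-distinctFillings⁺ (y ∷ ys) ∘ ∈-fillingsByFirstEntry⁻ (y ∷ ys))))

-- Sums and products in a commutative semiring

module BigOperators {c ℓ : Level} (R : CommutativeSemiring c ℓ) where
  open CommutativeSemiring R
  open import Relation.Binary.Reasoning.Setoid setoid
  open import Algebra.Properties.CommutativeSemigroup +-commutativeSemigroup using () renaming (x∙yz≈y∙xz to x+yz≈y+xz)
  open import Algebra.Properties.CommutativeSemigroup *-commutativeSemigroup using () renaming (x∙yz≈y∙xz to x*yz≈y*xz)

  ∑ : {A : Set} → List A → (A → Carrier) → Carrier
  ∑ xs f = sumR R (map f xs)

  ∏ : {A : Set} → List A → (A → Carrier) → Carrier
  ∏ xs f = prodR R (map f xs)

  module _ {A : Set} where

    ∑-cong : ∀ {f g : A → Carrier} xs → (∀ {x} → x ∈ xs → f x ≈ g x) → ∑ xs f ≈ ∑ xs g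
    ∑-cong []       f≈g = refl
    ∑-cong (x ∷ xs) f≈g = +-cong (f≈g (here ≡.refl)) (∑-cong xs (f≈g ∘ there))

    ∑-0 : ∀ {f : A → Carrier} xs → (∀ {x} → x ∈ xs → f x ≈ 0#) → ∑ xs f ≈ 0#
    ∑-0 []       f≈0 = refl
    ∑-0 (x ∷ xs) f≈0 = trans (+-cong (f≈0 (here ≡.refl)) (∑-0 xs (f≈0 ∘ there))) (+-identityˡ 0#)

    ∑-↭ : ∀ (f : A → Carrier) {xs ys} → xs ↭ ys → ∑ xs f ≈ ∑ ys f
    ∑-↭ f ↭.refl                = refl
    ∑-↭ f (↭.prep x xs↭ys)      = +-congˡ (∑-↭ f xs↭ys)
    ∑-↭ f (↭.swap x y xs↭ys)    = trans (+-congˡ (+-congˡ (∑-↭ f xs↭ys))) (x+yz≈y+xz (f x) (f y) _)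
    ∑-↭ f (↭.trans xs↭ys ys↭zs) = trans (∑-↭ f xs↭ys) (∑-↭ f ys↭zs)

    ∑-++ : ∀ (f : A → Carrier) xs ys → ∑ (xs ++ ys) f ≈ ∑ xs f + ∑ ys f
    ∑-++ f []       ys = sym (+-identityˡ _)
    ∑-++ f (x ∷ xs) ys = trans (+-congˡ (∑-++ f xs ys)) (sym (+-assoc _ _ _))

    *-∑ : ∀ a (f : A → Carrier) xs → a * ∑ xs f ≈ ∑ xs (λ x → a * f x)
    *-∑ a f []       = zeroʳ a
    *-∑ a f (x ∷ xs) = trans (distribˡ a _ _) (+-congˡ (*-∑ a f xs))

    ∑-* : ∀ a (f : A → Carrier) xs → ∑ xs f * a ≈ ∑ xs (λ x → f x * a)
    ∑-* a f []       = zeroˡ a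
    ∑-* a f (x ∷ xs) = trans (distribʳ a _ _) (+-congˡ (∑-* a f xs))

    ∏-cong : ∀ {f g : A → Carrier} xs → (∀ {x} → x ∈ xs → f x ≈ g x) → ∏ xs f ≈ ∏ xs g
    ∏-cong []       f≈g = refl
    ∏-cong (x ∷ xs) f≈g = *-cong (f≈g (here ≡.refl)) (∏-cong xs (f≈g ∘ there))

    ∏-1 : ∀ xs → ∏ xs (λ (_ : A) → 1#) ≈ 1#
    ∏-1 []       = refl
    ∏-1 (x ∷ xs) = trans (*-identityˡ _) (∏-1 xs)

  ∑-map : ∀ {A B : Set} (f : B → Carrier) (h : A → B) xs → ∑ (map h xs) f ≡ ∑ xs (f ∘ h)
  ∑-map f h xs = cong (sumR R) (≡.sym (map-∘ xs))

  ∑-concatMap : ∀ {A B : Set} (f : B → Carrier) (g : A → List B) xs →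
                ∑ (concatMap g xs) f ≈ ∑ xs (λ x → ∑ (g x) f)
  ∑-concatMap f g []       = refl
  ∑-concatMap f g (x ∷ xs) = trans (∑-++ f (g x) (concatMap g xs)) (+-congˡ (∑-concatMap f g xs))

  module _ {A : Set} {f g : A → Carrier} {t : A} where

    ∑-except : ∀ {c d} xs → Unique xs → t ∈ xs →
               (∀ {x} → x ∈ xs → x ≢ t → f x ≈ d * g x) → f t ≈ c + d * g t →
               ∑ xs f ≈ c + d * ∑ xs g
    ∑-except {c} {d} (x ∷ xs) (t∉xs ∷ _) (here ≡.refl) f≈dg ft≈ = begin
      f t + ∑ xs f                ≈⟨ +-cong ft≈ (trans (∑-cong xs rest) (sym (*-∑ d g xs))) ⟩
      (c + d * g t) + d * ∑ xs g  ≈⟨ +-assoc _ _ _ ⟩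
      c + (d * g t + d * ∑ xs g)  ≈⟨ +-congˡ (sym (distribˡ d _ _)) ⟩
      c + d * (g t + ∑ xs g)      ∎
      where
      rest : ∀ {y} → y ∈ xs → f y ≈ d * g y
      rest y∈xs = f≈dg (there y∈xs) λ { ≡.refl → All.lookup t∉xs y∈xs ≡.refl }
    ∑-except {c} {d} (x ∷ xs) (x∉xs ∷ xs-!) (there t∈xs) f≈dg ft≈ = begin
      f x + ∑ xs f                ≈⟨ +-cong (f≈dg (here ≡.refl) (All.lookup x∉xs t∈xs))
                                            (∑-except xs xs-! t∈xs (f≈dg ∘ there) ft≈) ⟩
      d * g x + (c + d * ∑ xs g)  ≈⟨ x+yz≈y+xz _ _ _ ⟩
      c + (d * g x + d * ∑ xs g)  ≈⟨ +-congˡ (sym (distribˡ d _ _)) ⟩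
      c + d * (g x + ∑ xs g)      ∎

    ∏-except : ∀ {c} xs → Unique xs → t ∈ xs →
               (∀ {x} → x ∈ xs → x ≢ t → f x ≈ g x) → f t ≈ c * g t →
               ∏ xs f ≈ c * ∏ xs g
    ∏-except {c} (x ∷ xs) (t∉xs ∷ _) (here ≡.refl) f≈g ft≈ = begin
      f t * ∏ xs f        ≈⟨ *-cong ft≈ (∏-cong xs rest) ⟩
      (c * g t) * ∏ xs g  ≈⟨ *-assoc _ _ _ ⟩
      c * (g t * ∏ xs g)  ∎
      where
      rest : ∀ {y} → y ∈ xs → f y ≈ g y
      rest y∈xs = f≈g (there y∈xs) λ { ≡.refl → All.lookup t∉xs y∈xs ≡.refl }
    ∏-except {c} (x ∷ xs) (x∉xs ∷ xs-!) (there t∈xs) f≈g ft≈ = begin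
      f x * ∏ xs f        ≈⟨ *-cong (f≈g (here ≡.refl) (All.lookup x∉xs t∈xs))
                                    (∏-except xs xs-! t∈xs (f≈g ∘ there) ft≈) ⟩
      g x * (c * ∏ xs g)  ≈⟨ x*yz≈y*xz _ _ _ ⟩
      c * (g x * ∏ xs g)  ∎

  pow-+ : ∀ q m n → pow R q (m ℕ.+ n) ≈ pow R q m * pow R q n
  pow-+ q zero    n = sym (*-identityˡ _)
  pow-+ q (suc m) n = trans (*-congˡ (pow-+ q m n)) (sym (*-assoc _ _ _))

-- Counting the entries below a given one

module CountingBelow
  {_≺_ : Rel ℕ 0ℓ} (_≺?_ : Decidable _≺_) (≺-trans : Transitive _≺_) (≺-compare : Trichotomous _≡_ _≺_)
  where

  ≺-irrefl : ∀ x → ¬ x ≺ x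
  ≺-irrefl x with ≺-compare x x
  ... | tri< _ _ x⊀x = x⊀x
  ... | tri≈ x⊀x _ _ = x⊀x
  ... | tri> x⊀x _ _ = x⊀x

  below : ℕ → List ℕ → ℕ
  below x xs = length (filter (_≺? x) xs)

  below-↭ : ∀ x {xs ys} → xs ↭ ys → below x xs ≡ below x ys
  below-↭ x = length-filter-↭ (_≺? x)

  below-∷-≺ : ∀ {x y} xs → y ≺ x → below x (y ∷ xs) ≡ suc (below x xs)
  below-∷-≺ xs y≺x = cong length (filter-accept (_≺? _) y≺x)

  below-∷-⊀ : ∀ {x y} xs → ¬ y ≺ x → below x (y ∷ xs) ≡ below x xs
  below-∷-⊀ xs y⊀x = cong length (filter-reject (_≺? _) y⊀x)

  below-minimum : ∀ {t xs} → All (λ z → ¬ z ≺ t) xs → below t xs ≡ 0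
  below-minimum t-min = cong length (filter-none (_≺? _) t-min)

  minimum : ∀ y ys → ∃ λ t → t ∈ y ∷ ys × All (λ z → ¬ z ≺ t) (y ∷ ys)
  minimum y []        = y , here ≡.refl , ≺-irrefl y ∷ []
  minimum y (y′ ∷ ys) with minimum y′ ys
  ... | t , t∈ , t-min with y ≺? t
  ...   | yes y≺t = y , here ≡.refl , ≺-irrefl y ∷ All.map (λ z⊀t z≺y → z⊀t (≺-trans z≺y y≺t)) t-min
  ...   | no  y⊀t = t , there t∈ , y⊀t ∷ t-min

  module _ {c ℓ : Level} (R : CommutativeSemiring c ℓ) (q : CommutativeSemiring.Carrier R) where
    open CommutativeSemiring R
    open BigOperators R
    open import Relation.Binary.Reasoning.Setoid setoid

    weight : List ℕ → ℕ → Carrier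
    weight xs x = pow R q (below x xs) * qInt R q (mult x xs)

    weight-↭ : ∀ {xs ys} → xs ↭ ys → ∀ x → weight xs x ≈ weight ys x
    weight-↭ xs↭ys x = reflexive (cong₂ (λ k m → pow R q k * qInt R q m) (below-↭ x xs↭ys) (mult-↭ x xs↭ys))

    weight-∷-minimum : ∀ {t xs} → All (λ z → ¬ z ≺ t) xs → weight (t ∷ xs) t ≈ 1# + q * weight xs t
    weight-∷-minimum {t} {xs} t-min = begin
      pow R q (below t (t ∷ xs)) * qInt R q (mult t (t ∷ xs))
        ≈⟨ reflexive (cong₂ (λ k m → pow R q k * qInt R q m) below≡0 (mult-∷-≡ t xs)) ⟩
      1# * (1# + q * qInt R q (mult t xs))         ≈⟨ *-identityˡ _ ⟩
      1# + q * qInt R q (mult t xs)                ≈⟨ +-congˡ (*-congˡ (sym (*-identityˡ _))) ⟩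
      1# + q * (1# * qInt R q (mult t xs))
        ≈⟨ +-congˡ (*-congˡ (*-congʳ (reflexive (cong (pow R q) (≡.sym (below-minimum t-min)))))) ⟩
      1# + q * weight xs t                         ∎
      where
      below≡0 : below t (t ∷ xs) ≡ 0
      below≡0 = ≡.trans (below-∷-⊀ xs (≺-irrefl t)) (below-minimum t-min)

    weight-∷-other : ∀ {t xs x} → All (λ z → ¬ z ≺ t) xs → x ≢ t → weight (t ∷ xs) x ≈ q * weight xs x
    weight-∷-other {t} {xs} {x} t-min x≢t with ≺-compare t x
    ... | tri< t≺x _ _ = begin
      pow R q (below x (t ∷ xs)) * qInt R q (mult x (t ∷ xs))
        ≈⟨ reflexive (cong₂ (λ k m → pow R q k * qInt R q m) (below-∷-≺ xs t≺x) (mult-∷-≢ xs (x≢t ∘ ≡.sym))) ⟩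
      (q * pow R q (below x xs)) * qInt R q (mult x xs) ≈⟨ *-assoc _ _ _ ⟩
      q * weight xs x                                   ∎
    ... | tri≈ _ t≡x _ = contradiction (≡.sym t≡x) x≢t
    ... | tri> _ _ x≺t = begin
      pow R q (below x (t ∷ xs)) * qInt R q (mult x (t ∷ xs))
        ≈⟨ *-congˡ (reflexive (cong (qInt R q) (≡.trans (mult-∷-≢ xs (x≢t ∘ ≡.sym)) mult≡0))) ⟩
      pow R q (below x (t ∷ xs)) * 0#   ≈⟨ zeroʳ _ ⟩
      0#                                ≈⟨ sym (zeroʳ q) ⟩
      q * 0#                            ≈⟨ *-congˡ (sym (zeroʳ _)) ⟩
      q * (pow R q (below x xs) * 0#)   ≈⟨ *-congˡ (*-congˡ (reflexive (cong (qInt R q) (≡.sym mult≡0)))) ⟩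
      q * weight xs x                   ∎
      where
      mult≡0 : mult x xs ≡ 0
      mult≡0 = mult-∉ λ x∈xs → All.lookup t-min x∈xs x≺t

    ∑-weight : ∀ n xs → length xs ≡ n → ∀ L → Unique L → xs ⊆ L → ∑ L (weight xs) ≈ qInt R q n
    ∑-weight zero    []       _   L L-! _    = ∑-0 L λ _ → zeroʳ _
    ∑-weight (suc n) (y ∷ ys) len L L-! xs⊆L with minimum y ys
    ... | t , t∈xs , t-min = begin
      ∑ L (weight xs)           ≈⟨ ∑-cong L (λ {x} _ → weight-↭ xs↭ x) ⟩
      ∑ L (weight (t ∷ xs′))
        ≈⟨ ∑-except L L-! (xs⊆L t∈xs) (λ _ → weight-∷-other t-min′) (weight-∷-minimum t-min′) ⟩
      1# + q * ∑ L (weight xs′) ≈⟨ +-congˡ (*-congˡ (∑-weight n xs′ len′ L L-! (xs⊆L ∘ delete-⊆ t∈xs))) ⟩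
      1# + q * qInt R q n       ∎
      where
      xs = y ∷ ys
      xs′ = delete t xs
      xs↭ : xs ↭ t ∷ xs′
      xs↭ = ↭-delete t∈xs
      len′ : length xs′ ≡ n
      len′ = ℕ.suc-injective (≡.trans (≡.sym (↭-length xs↭)) len)
      t-min′ : All (λ z → ¬ z ≺ t) xs′
      t-min′ = All.tabulate (All.lookup t-min ∘ delete-⊆ t∈xs)

-- The relative-inversion order

-- v ≺⟨ b ⟩ u when v comes before u reading ℕ cyclically from b + 1: first the values above b, then those at
-- most b, each increasingly. The key (x ≤ᵇ b , x) realises this as a lexicographic order.
_≺⟨_⟩_ : ℕ → ℕ → ℕ → Set
v ≺⟨ b ⟩ u = relInv u b v ≡ true

_≺⟨_⟩?_ : ∀ v b u → Dec (v ≺⟨ b ⟩ u)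
v ≺⟨ b ⟩? u = relInv u b v ≟ᵇ true

_<ₗₑₓ_ : Rel (Bool × ℕ) 0ℓ
_<ₗₑₓ_ = ×-Lex _≡_ Bool._<_ ℕ._<_

<ᵇ≡not-≤ᵇ : ∀ m n → (m <ᵇ n) ≡ not (n ≤ᵇ m)
<ᵇ≡not-≤ᵇ m       zero          = ≡.refl
<ᵇ≡not-≤ᵇ zero    (suc n)       = ≡.refl
<ᵇ≡not-≤ᵇ (suc m) (suc zero)    = ≡.refl
<ᵇ≡not-≤ᵇ (suc m) (suc (suc n)) = <ᵇ≡not-≤ᵇ m (suc n)

≺⟨⟩⇒<ₗₑₓ : ∀ v b u → v ≺⟨ b ⟩ u → ((v ≤ᵇ b) , v) <ₗₑₓ ((u ≤ᵇ b) , u)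
≺⟨⟩⇒<ₗₑₓ v b u rewrite <ᵇ≡not-≤ᵇ b v with u ≤ᵇ b | v ≤ᵇ b | v <ᵇ u | ℕ.<ᵇ-reflects-< v u
... | true  | true  | true  | ofʸ v<u = λ _ → inj₂ (≡.refl , v<u)
... | true  | false | _     | _       = λ _ → inj₁ f<t
... | false | false | true  | ofʸ v<u = λ _ → inj₂ (≡.refl , v<u)
... | true  | true  | false | _       = λ ()
... | false | true  | true  | _       = λ ()
... | false | true  | false | _       = λ ()
... | false | false | false | _       = λ ()

<ₗₑₓ⇒≺⟨⟩ : ∀ v b u → ((v ≤ᵇ b) , v) <ₗₑₓ ((u ≤ᵇ b) , u) → v ≺⟨ b ⟩ u
<ₗₑₓ⇒≺⟨⟩ v b u rewrite <ᵇ≡not-≤ᵇ b v with u ≤ᵇ b | v ≤ᵇ b | v <ᵇ u | ℕ.<ᵇ-reflects-< v u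
... | true  | true  | true  | _        = λ _ → ≡.refl
... | true  | false | _     | _        = λ _ → ≡.refl
... | false | false | true  | _        = λ _ → ≡.refl
... | true  | true  | false | ofⁿ v≮u = λ { (inj₁ ()) ; (inj₂ (_ , v<u)) → contradiction v<u v≮u }
... | false | true  | _     | _        = λ { (inj₁ ()) ; (inj₂ (() , _)) }
... | false | false | false | ofⁿ v≮u = λ { (inj₁ ()) ; (inj₂ (_ , v<u)) → contradiction v<u v≮u }

module RelativeOrder (b : ℕ) where
  private
    key : ℕ → Bool × ℕ
    key x = (x ≤ᵇ b) , x
    module Lex = IsStrictTotalOrder (×-isStrictTotalOrder Bool.<-isStrictTotalOrder ℕ.<-isStrictTotalOrder)

  ≺-trans : Transitive (_≺⟨ b ⟩_)
  ≺-trans {x} {y} {z} x≺y y≺z = <ₗₑₓ⇒≺⟨⟩ x b z (Lex.trans (≺⟨⟩⇒<ₗₑₓ x b y x≺y) (≺⟨⟩⇒<ₗₑₓ y b z y≺z))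

  ≺-compare : Trichotomous _≡_ (_≺⟨ b ⟩_)
  ≺-compare x y with Lex.compare (key x) (key y)
  ... | tri< x<y _ y≮x =
    tri< (<ₗₑₓ⇒≺⟨⟩ x b y x<y) (λ { ≡.refl → Lex.irrefl (≡.refl , ≡.refl) x<y }) (y≮x ∘ ≺⟨⟩⇒<ₗₑₓ y b x)
  ... | tri≈ x≮y (_ , x≡y) y≮x =
    tri≈ (x≮y ∘ ≺⟨⟩⇒<ₗₑₓ x b y) x≡y (y≮x ∘ ≺⟨⟩⇒<ₗₑₓ y b x)
  ... | tri> x≮y _ y<x =
    tri> (x≮y ∘ ≺⟨⟩⇒<ₗₑₓ x b y) (λ { ≡.refl → Lex.irrefl (≡.refl , ≡.refl) y<x }) (<ₗₑₓ⇒≺⟨⟩ y b x y<x)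

  -- relInv is not injective, so the implicit arguments of ≺-trans cannot be inferred by unification.
  open CountingBelow {_≺⟨ b ⟩_} (λ v u → v ≺⟨ b ⟩? u) (λ {x y z} → ≺-trans {x} {y} {z}) ≺-compare public

-- Splitting off the first entry

module _ {c ℓ : Level} (R : CommutativeSemiring c ℓ) (q : CommutativeSemiring.Carrier R) where
  open CommutativeSemiring R
  open BigOperators R
  open import Relation.Binary.Reasoning.Setoid setoid
  open import Algebra.Properties.CommutativeSemigroup *-commutativeSemigroup using () renaming (interchange to *-interchange)

  multFactProdOver : List ℕ → List ℕ → Carrier
  multFactProdOver L xs = ∏ L (λ v → qFact R q (mult v xs))

  multFactProdOver-∷ : ∀ {L y} xs → Unique L → y ∈ L →
                       multFactProdOver L (y ∷ xs) ≈ qInt R q (suc (mult y xs)) * multFactProdOver L xs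
  multFactProdOver-∷ {L} {y} xs L-! y∈L = ∏-except L L-! y∈L
    (λ _ v≢y → reflexive (cong (qFact R q) (mult-∷-≢ xs (v≢y ∘ ≡.sym))))
    (reflexive (cong (qFact R q) (mult-∷-≡ y xs)))

  -- Values of L outside xs contribute (0)_q! = 1.
  multFactProdOver-independent : ∀ xs {L L′} → Unique L → Unique L′ → xs ⊆ L → xs ⊆ L′ →
                                 multFactProdOver L xs ≈ multFactProdOver L′ xs
  multFactProdOver-independent []       {L} {L′} _ _ _ _ = trans (∏-1 L) (sym (∏-1 L′))
  multFactProdOver-independent (y ∷ xs) {L} {L′} L-! L′-! xs⊆L xs⊆L′ = begin
    multFactProdOver L (y ∷ xs)                        ≈⟨ multFactProdOver-∷ xs L-! (xs⊆L (here ≡.refl)) ⟩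
    qInt R q (suc (mult y xs)) * multFactProdOver L xs
      ≈⟨ *-congˡ (multFactProdOver-independent xs L-! L′-! (xs⊆L ∘ there) (xs⊆L′ ∘ there)) ⟩
    qInt R q (suc (mult y xs)) * multFactProdOver L′ xs ≈⟨ sym (multFactProdOver-∷ xs L′-! (xs⊆L′ (here ≡.refl))) ⟩
    multFactProdOver L′ (y ∷ xs)                       ∎

  multFactProd-delete : ∀ {x xs} → x ∈ xs →
                        multFactProd R q xs ≈ qInt R q (mult x xs) * multFactProd R q (delete x xs)
  multFactProd-delete {x} {xs} x∈xs = begin
    multFactProdOver (distinctValues xs) xs
      ≈⟨ ∏-cong (distinctValues xs) (λ {v} _ → reflexive (cong (qFact R q) (mult-↭ v xs↭))) ⟩
    multFactProdOver (distinctValues xs) (x ∷ xs′)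
      ≈⟨ multFactProdOver-∷ xs′ (distinctValues-! xs) (∈-distinctValues⁺ x∈xs) ⟩
    qInt R q (suc (mult x xs′)) * multFactProdOver (distinctValues xs) xs′
      ≈⟨ *-cong (reflexive (cong (qInt R q) (≡.sym (≡.trans (mult-↭ x xs↭) (mult-∷-≡ x xs′)))))
                (multFactProdOver-independent xs′ (distinctValues-! xs) (distinctValues-! xs′)
                   (∈-distinctValues⁺ ∘ delete-⊆ x∈xs) ∈-distinctValues⁺) ⟩
    qInt R q (mult x xs) * multFactProdOver (distinctValues xs′) xs′ ∎
    where
    xs′ = delete x xs
    xs↭ : xs ↭ x ∷ xs′
    xs↭ = ↭-delete x∈xs

  open RelativeOrder using (below; ≺-irrefl; below-↭; below-∷-⊀; weight; ∑-weight)

  invGenByFirstEntry : ℕ → List ℕ → List ℕ → ℕ → Carrier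
  invGenByFirstEntry b w xs x = pow R q (below b x xs) * invGen R q w (delete x xs)

  invGen-∷ : ∀ b w y ys → invGen R q (b ∷ w) (y ∷ ys) ≈ ∑ (distinctValues (y ∷ ys)) (invGenByFirstEntry b w (y ∷ ys))
  invGen-∷ b w y ys = begin
    ∑ (distinctFillings xs) f
      ≈⟨ ∑-↭ f (distinctFillings-↭-byFirstEntry y ys) ⟩
    ∑ (fillingsByFirstEntry xs) f
      ≈⟨ ∑-concatMap f (fillingsStartingWith xs) (distinctValues xs) ⟩
    ∑ (distinctValues xs) (λ x → ∑ (fillingsStartingWith xs x) f)
      ≈⟨ ∑-cong (distinctValues xs) (starting-with ∘ ∈-distinctValues⁻ xs) ⟩
    ∑ (distinctValues xs) (invGenByFirstEntry b w xs) ∎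
    where
    xs = y ∷ ys
    f : List ℕ → Carrier
    f r = pow R q (inv (b ∷ w) r)
    below-delete : ∀ {x zs} → x ∈ xs → zs ↭ delete x xs → below b x zs ≡ below b x xs
    below-delete {x} x∈xs zs↭ = ≡.trans (below-↭ b x zs↭)
      (≡.sym (≡.trans (below-↭ b x (↭-delete x∈xs)) (below-∷-⊀ b {x} {x} (delete x xs) (≺-irrefl b x))))
    starting-with : ∀ {x} → x ∈ xs → ∑ (fillingsStartingWith xs x) f ≈ invGenByFirstEntry b w xs x
    starting-with {x} x∈xs = begin
      ∑ (map (x ∷_) fillings) f
        ≡⟨ ∑-map f (x ∷_) fillings ⟩
      ∑ fillings (λ zs → pow R q (below b x zs ℕ.+ inv w zs))
        ≈⟨ ∑-cong fillings split ⟩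
      ∑ fillings (λ zs → pow R q (below b x xs) * pow R q (inv w zs))
        ≈⟨ sym (*-∑ (pow R q (below b x xs)) (λ zs → pow R q (inv w zs)) fillings) ⟩
      pow R q (below b x xs) * invGen R q w (delete x xs) ∎
      where
      fillings = distinctFillings (delete x xs)
      split : ∀ {zs} → zs ∈ fillings →
              pow R q (below b x zs ℕ.+ inv w zs) ≈ pow R q (below b x xs) * pow R q (inv w zs)
      split {zs} zs∈ = trans (pow-+ q (below b x zs) (inv w zs))
        (*-congʳ (reflexive (cong (pow R q) (below-delete x∈xs (∈-distinctFillings⁻ _ zs∈)))))

  invGen-*-multFactProd : ∀ n w xs → length xs ≡ n → n ≤ length w →
                          invGen R q w xs * multFactProd R q xs ≈ qFact R q n
  invGen-*-multFactProd zero    []      [] _ _ = trans (*-identityʳ _) (+-identityʳ _)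
  invGen-*-multFactProd zero    (b ∷ w) [] _ _ = trans (*-identityʳ _) (+-identityʳ _)
  invGen-*-multFactProd (suc n) (b ∷ w) (y ∷ ys) len (s≤s n≤) = begin
    invGen R q (b ∷ w) xs * M xs
      ≈⟨ *-congʳ (invGen-∷ b w y ys) ⟩
    ∑ (distinctValues xs) byFirst * M xs
      ≈⟨ ∑-* (M xs) byFirst (distinctValues xs) ⟩
    ∑ (distinctValues xs) (λ x → byFirst x * M xs)
      ≈⟨ ∑-cong (distinctValues xs) (first-entry ∘ ∈-distinctValues⁻ xs) ⟩
    ∑ (distinctValues xs) (λ x → weight b R q xs x * qFact R q n)
      ≈⟨ sym (∑-* (qFact R q n) (weight b R q xs) (distinctValues xs)) ⟩
    ∑ (distinctValues xs) (weight b R q xs) * qFact R q n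
      ≈⟨ *-congʳ (∑-weight b R q (suc n) xs len (distinctValues xs) (distinctValues-! xs) ∈-distinctValues⁺) ⟩
    qInt R q (suc n) * qFact R q n ∎
    where
    xs = y ∷ ys
    M = multFactProd R q
    byFirst = invGenByFirstEntry b w xs
    first-entry : ∀ {x} → x ∈ xs → byFirst x * M xs ≈ weight b R q xs x * qFact R q n
    first-entry {x} x∈xs = begin
      byFirst x * M xs
        ≈⟨ *-congˡ (multFactProd-delete x∈xs) ⟩
      byFirst x * (qInt R q (mult x xs) * M (delete x xs))
        ≈⟨ *-interchange _ _ _ _ ⟩
      weight b R q xs x * (invGen R q w (delete x xs) * M (delete x xs))
        ≈⟨ *-congˡ (invGen-*-multFactProd n w (delete x xs) len′ n≤) ⟩
      weight b R q xs x * qFact R q n ∎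
      where
      len′ : length (delete x xs) ≡ n
      len′ = ℕ.suc-injective (≡.trans (≡.sym (↭-length (↭-delete x∈xs))) len)

open import Data.Nat using (_+_)

part-antitone : ∀ {lam} → IsPartition lam → ∀ j → part lam (suc (suc j)) ≤ part lam (suc j)
part-antitone {[]}        _                 j       = ℕ.z≤n
part-antitone {x ∷ []}    _                 j       = ℕ.z≤n
part-antitone {x ∷ y ∷ _} (x≥y Linked.∷ _)  zero    = x≥y
part-antitone {x ∷ y ∷ _} (_ Linked.∷ rest) (suc j) = part-antitone rest j

-- The hypotheses that λ_{i+1} ≥ 1 and that all entries are positive are not needed.
mainTheorem18 : {c ℓ : Level} (R : CommutativeSemiring c ℓ) (q : CommutativeSemiring.Carrier R)
    (lam : List ℕ) (i : ℕ) (w a : List ℕ) →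
    IsPartition lam → 1 ≤ i → 1 ≤ part lam (i + 1) →
    length w ≡ part lam i → All (1 ≤_) w →
    length a ≡ part lam (i + 1) → All (1 ≤_) a →
    CommutativeSemiring._≈_ R
      (CommutativeSemiring._*_ R (invGen R q w a) (multFactProd R q a))
      (qFact R q (part lam (i + 1)))
mainTheorem18 R q lam (suc j) w a lam-partition _ _ len-w _ len-a _ =
  invGen-*-multFactProd R q (part lam (suc j + 1)) w a len-a row-lengths
  where
  row-lengths : part lam (suc j + 1) ≤ length w
  row-lengths rewrite len-w | ℕ.+-comm j 1 = part-antitone lam-partition j
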